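{- For any positive integers $b$ and $c$, $$f_{0,b,c}(x) = \frac{1 - x + x^{b+1} f_{0,0,c-1}(x)}{(1-x)(1-x-\cdots - x^b)}.$$
   Context: $S_n$ is the set of permutations of $\{1,\dots,n\}$ in one-line notation; $\pi$ avoids $\sigma\in S_k$ if no subsequence of $\pi$ of length $k$ has the same relative order as $\sigma$; $S_n(R)$ is the set of $\pi\in S_n$ avoiding every element of $R$, and $S_0(R)$ contains only the empty permutation. For nonnegative integers $a,b,c$, $\gamma_{a,b,c}\in S_{a+b+c+1}$ is $$\gamma_{a,b,c} = a+b+c+1, a+b+c, \ldots, b+c+2,\ b+c, b+c-1, \ldots, c+1,\ b+c+1,\ c, c-1, \ldots, 2, 1,$$ and $f_{a,b,c}(x) = \sum_{n\ge 0} |S_n(123, 132, \gamma_{a,b,c})| x^n$. -}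

module Defs where

open import Data.Bool using (Bool; true; false; _∧_; not; if_then_else_)
open import Data.Nat using (ℕ; zero; suc; _+_; _∸_; _≤ᵇ_) renaming (_<ᵇ_ to _<ᵇ_; _≡ᵇ_ to _≡ᵇ_)
open import Data.List using (List; []; _∷_; _++_; map; concatMap; filterᵇ; length; zip; upTo; applyUpTo; foldr)
open import Data.Product using (_,_)
open import Data.Integer using (ℤ) renaming (_+_ to _+ℤ_; _*_ to _*ℤ_; -_ to -ℤ_; +_ to ℤ+)

_⇔ᵇ_ : Bool → Bool → Bool
true ⇔ᵇ b = b
false ⇔ᵇ b = not b

allᵇ : {A : Set} → (A → Bool) → List A → Bool
allᵇ p [] = true
allᵇ p (x ∷ xs) = p x ∧ allᵇ p xs

anyᵇ : {A : Set} → (A → Bool) → List A → Bool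
anyᵇ p [] = false
anyᵇ p (x ∷ xs) = if p x then true else anyᵇ p xs

oneTo : ℕ → List ℕ
oneTo n = applyUpTo suc n

words : ℕ → ℕ → List (List ℕ)
words n zero = [] ∷ []
words n (suc k) = concatMap (λ w → map (_∷ w) (oneTo n)) (words n k)

distinct : List ℕ → Bool
distinct [] = true
distinct (x ∷ xs) = allᵇ (λ y → not (x ≡ᵇ y)) xs ∧ distinct xs

S : ℕ → List (List ℕ)
S n = filterᵇ distinct (words n n)

subseqs : List ℕ → List (List ℕ)
subseqs [] = [] ∷ []
subseqs (x ∷ xs) = map (x ∷_) (subseqs xs) ++ subseqs xs

sameOrder : List ℕ → List ℕ → Bool
sameOrder [] [] = true
sameOrder [] (_ ∷ _) = false
sameOrder (_ ∷ _) [] = false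
sameOrder (x ∷ xs) (y ∷ ys) =
  (length xs ≡ᵇ length ys)
  ∧ allᵇ (λ { (x′ , y′) → ((x <ᵇ x′) ⇔ᵇ (y <ᵇ y′)) ∧ ((x′ <ᵇ x) ⇔ᵇ (y′ <ᵇ y)) }) (zip xs ys)
  ∧ sameOrder xs ys

contains : List ℕ → List ℕ → Bool
contains π σ = anyᵇ (λ s → sameOrder s σ) (subseqs π)

avoids : List ℕ → List ℕ → Bool
avoids π σ = not (contains π σ)

SAvoid : ℕ → List (List ℕ) → List (List ℕ)
SAvoid n R = filterᵇ (λ π → allᵇ (avoids π) R) (S n)

countAvoid : ℕ → List (List ℕ) → ℕ
countAvoid n R = length (SAvoid n R)

p123 : List ℕ
p123 = 1 ∷ 2 ∷ 3 ∷ []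

p132 : List ℕ
p132 = 1 ∷ 3 ∷ 2 ∷ []

desc : ℕ → ℕ → List ℕ
desc lo zero = []
desc lo (suc k) = (lo + k) ∷ desc lo k

-- γ_{a,b,c} = a+b+c+1, ..., b+c+2, b+c, ..., c+1, b+c+1, c, ..., 1
γ : ℕ → ℕ → ℕ → List ℕ
γ a b c = desc (b + c + 2) a ++ desc (c + 1) b ++ ((b + c + 1) ∷ desc 1 c)

FPS : Set
FPS = ℕ → ℤ

_≈ₛ_ : FPS → FPS → Set
f ≈ₛ g = ∀ n → f n ≡ g n
  where open import Relation.Binary.PropositionalEquality using (_≡_)

_+ₛ_ : FPS → FPS → FPS
(f +ₛ g) n = f n +ℤ g n

-ₛ_ : FPS → FPS
(-ₛ f) n = -ℤ (f n)

_-ₛ_ : FPS → FPS → FPS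
f -ₛ g = f +ₛ (-ₛ g)

sumℤ : List ℤ → ℤ
sumℤ = foldr _+ℤ_ (ℤ+ 0)

_*ₛ_ : FPS → FPS → FPS
(f *ₛ g) n = sumℤ (map (λ i → f i *ℤ g (n ∸ i)) (upTo (suc n)))

X^ : ℕ → FPS
X^ k n = if n ≡ᵇ k then ℤ+ 1 else ℤ+ 0

oneₛ : FPS
oneₛ = X^ 0

sumPowers : ℕ → FPS
sumPowers zero = λ _ → ℤ+ 0
sumPowers (suc b) = sumPowers b +ₛ X^ (suc b)

f : ℕ → ℕ → ℕ → FPS
f a b c n = ℤ+ (countAvoid n (p123 ∷ p132 ∷ γ a b c ∷ []))

module Submission where

-- A permutation avoiding 123 and 132 has, around its largest entry n = m + j + 1, the shape
-- (m + j, …, m + 1, n, v) with v ∈ S_m(123, 132).  It contains γ_{0,b,c} exactly when v does,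
-- or when j ≥ b and v has a decreasing subsequence of length c, i.e. v contains γ_{0,0,c-1}.
-- So the coefficients a_n of f_{0,b,c} and d_n of f_{0,0,c-1} satisfy
-- a_{n+1} = Σ_{j<b} a_{n-j} + Σ_{j≥b} d_{n-j}, and comparing two consecutive instances gives
-- a_{n+2} - 2 a_{n+1} + a_{n+1-b} = d_{n+1-b}: the coefficient of x^{n+2} in the claimed
-- identity, once (1 - x)(1 - x - ⋯ - x^b) is expanded to 1 - 2x + x^{b+1}.

open import Defs
open import Data.Bool using (Bool; true; false; T; T?; not; _∧_; if_then_else_)
open import Data.Bool.Properties using (T-∧; if-float)
open import Data.Empty using (⊥-elim)
open import Data.Nat using (ℕ; zero; suc; _+_; _∸_; _≤_; _<_; _>_; z≤n; s≤s; z<s; s<s; _≟_; _≡ᵇ_; _<ᵇ_)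
open import Data.Nat.Properties
open import Data.Nat.Tactic.RingSolver using (solve-∀)
open import Data.Integer using (ℤ; 0ℤ; 1ℤ) renaming (_+_ to _+ℤ_; _*_ to _*ℤ_; -_ to -ℤ_)
import Data.Integer.Properties as ℤ
open import Data.Integer.Tactic.RingSolver renaming (solve-∀ to ℤ-solve-∀)
open import Data.Product using (∃-syntax; Σ-syntax; _×_; _,_; proj₁; proj₂; uncurry)
open import Data.Sum using (_⊎_; inj₁; inj₂; [_,_]′)
open import Data.Unit using (tt)
open import Data.List using (List; []; _∷_; _++_; map; length; zip; filter; applyUpTo)
open import Data.List.Properties
  using (length-++; length-map; ∷-injective; filter-all; filter-accept; filter-reject)
open import Data.List.Membership.Propositional.Properties.WithK using (unique∧set⇒bag)
open import Data.List.Relation.Binary.BagAndSetEquality using (∼bag⇒↭)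
open import Data.List.Relation.Binary.Permutation.Propositional.Properties using (↭-length)
open import Data.List.Relation.Unary.All as All using (All; []; _∷_)
open import Data.List.Relation.Unary.All.Properties
  using (++⁻ʳ; ++⁻ˡ; all-filter; ¬Any⇒All¬) renaming (++⁺ to All-++⁺; map⁺ to All-map⁺)
open import Data.List.Relation.Binary.Disjoint.Propositional using (Disjoint)
open import Data.List.Relation.Unary.Any using (Any; here; there)
open import Data.List.Relation.Unary.AllPairs as AllPairs using (AllPairs; []; _∷_)
import Data.List.Relation.Unary.AllPairs.Properties as AllPairs
open import Data.List.Relation.Unary.Unique.Propositional using (Unique)
import Data.List.Relation.Unary.Unique.Propositional.Properties as Unique
import Data.List.Relation.Binary.Pointwise as Pointwise
open Pointwise using (Pointwise; []; _∷_; Pointwise-length)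
open import Data.List.Relation.Binary.Sublist.Propositional
  using (_⊆_; []; _∷_; _∷ʳ_; ⊆-refl; ⊆-trans; minimum; from∈)
open import Data.List.Relation.Binary.Sublist.Propositional.Properties
  using (All-resp-⊆; length-mono-≤; ++⁺; ++⁺ˡ; filter-⊆)
open import Data.List.Membership.Propositional using (_∈_; find; lose)
open import Data.List.Membership.Propositional.Properties
  using ( ∈-concatMap⁺; ∈-concatMap⁻; ∈-applyUpTo⁺; ∈-applyUpTo⁻; ∈-filter⁺; ∈-filter⁻; ∈-∃++
        ; ∈-map⁺; ∈-map⁻; ∈-++⁺ˡ; ∈-++⁺ʳ; ∈-++⁻)
open import Function using (id; _∘_; _⇔_; mk⇔; Equivalence)
import Function.Properties.Equivalence as ⇔
open import Relation.Nullary using (¬_; ¬?; yes; no)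
open import Data.List.Membership.DecPropositional _≟_ using (_∈?_)
open import Relation.Binary.PropositionalEquality

T-∧⁻ : ∀ {a b} → T (a ∧ b) → T a × T b
T-∧⁻ = Equivalence.to T-∧

T-∧⁺ : ∀ {a b} → T a → T b → T (a ∧ b)
T-∧⁺ p q = Equivalence.from T-∧ (p , q)

T-⇔ᵇ : ∀ a b → T (a ⇔ᵇ b) ⇔ (T a ⇔ T b)
T-⇔ᵇ true  true  = mk⇔ (λ _ → mk⇔ _ _) _
T-⇔ᵇ true  false = mk⇔ (λ ()) (λ e → Equivalence.to e tt)
T-⇔ᵇ false true  = mk⇔ (λ ()) (λ e → Equivalence.from e tt)
T-⇔ᵇ false false = mk⇔ (λ _ → mk⇔ (λ ()) (λ ())) _

allᵇ⇒All : ∀ {A : Set} (p : A → Bool) xs → T (allᵇ p xs) → All (T ∘ p) xs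
allᵇ⇒All p []       _ = []
allᵇ⇒All p (x ∷ xs) t = proj₁ (T-∧⁻ t) ∷ allᵇ⇒All p xs (proj₂ (T-∧⁻ {p x} t))

All⇒allᵇ : ∀ {A : Set} (p : A → Bool) {xs} → All (T ∘ p) xs → T (allᵇ p xs)
All⇒allᵇ p []       = tt
All⇒allᵇ p (t ∷ ts) = T-∧⁺ t (All⇒allᵇ p ts)

anyᵇ⇒Any : ∀ {A : Set} (p : A → Bool) xs → T (anyᵇ p xs) → Any (T ∘ p) xs
anyᵇ⇒Any p (x ∷ xs) t with p x in eq
... | true  = here (subst T (sym eq) tt)
... | false = there (anyᵇ⇒Any p xs t)

Any⇒anyᵇ : ∀ {A : Set} (p : A → Bool) {xs} → Any (T ∘ p) xs → T (anyᵇ p xs)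
Any⇒anyᵇ p {x ∷ _} (here t) with p x
... | true = tt
Any⇒anyᵇ p {x ∷ _} (there a) with p x
... | true  = tt
... | false = Any⇒anyᵇ p a

T-not⇒¬T : ∀ {b} → T (not b) → ¬ T b
T-not⇒¬T {false} _ ()

¬T⇒T-not : ∀ {b} → ¬ T b → T (not b)
¬T⇒T-not {false} _  = tt
¬T⇒T-not {true}  ¬t = ¬t tt

T-<ᵇ : ∀ m n → T (m <ᵇ n) ⇔ m < n
T-<ᵇ m n = mk⇔ (<ᵇ⇒< m n) <⇒<ᵇ

<ᵇ-true⇒< : ∀ {j k} → (j <ᵇ k) ≡ true → j < k
<ᵇ-true⇒< {j} {k} eq = <ᵇ⇒< j k (subst T (sym eq) tt)

<ᵇ-false⇒≥ : ∀ {j k} → (j <ᵇ k) ≡ false → k ≤ j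
<ᵇ-false⇒≥ eq = ≮⇒≥ (λ j<k → subst T eq (<⇒<ᵇ j<k))

allᵇ-cong : ∀ {A : Set} {p q : A → Bool} → (∀ a → p a ≡ q a) → ∀ xs → allᵇ p xs ≡ allᵇ q xs
allᵇ-cong p≗q []       = refl
allᵇ-cong p≗q (x ∷ xs) = cong₂ _∧_ (p≗q x) (allᵇ-cong p≗q xs)

OrderAgrees : ℕ → ℕ → ℕ → ℕ → Set
OrderAgrees x y x′ y′ = (x < x′ ⇔ y < y′) × (x′ < x ⇔ y′ < y)

data SameOrder : List ℕ → List ℕ → Set where
  []  : SameOrder [] []
  _∷_ : ∀ {x y xs ys} → Pointwise (OrderAgrees x y) xs ys → SameOrder xs ys →
        SameOrder (x ∷ xs) (y ∷ ys)

⊆⇒∈-subseqs : ∀ {s t} → s ⊆ t → s ∈ subseqs t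
⊆⇒∈-subseqs []                 = here refl
⊆⇒∈-subseqs {t = x ∷ t} (refl ∷ p) = ∈-++⁺ˡ (∈-map⁺ (x ∷_) (⊆⇒∈-subseqs p))
⊆⇒∈-subseqs {t = x ∷ t} (.x ∷ʳ p)  = ∈-++⁺ʳ (map (x ∷_) (subseqs t)) (⊆⇒∈-subseqs p)

∈-subseqs⇒⊆ : ∀ {s} t → s ∈ subseqs t → s ⊆ t
∈-subseqs⇒⊆ []      (here refl) = []
∈-subseqs⇒⊆ (x ∷ t) m with ∈-++⁻ (map (x ∷_) (subseqs t)) m
... | inj₂ m′ = x ∷ʳ ∈-subseqs⇒⊆ t m′
... | inj₁ m′ with ∈-map⁻ (x ∷_) m′
...   | _ , m″ , refl = refl ∷ ∈-subseqs⇒⊆ t m″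

Contains : List ℕ → List ℕ → Set
Contains π σ = ∃[ s ] s ⊆ π × SameOrder s σ

agreeᵇ : ℕ → ℕ → ℕ × ℕ → Bool
agreeᵇ x y (x′ , y′) = ((x <ᵇ x′) ⇔ᵇ (y <ᵇ y′)) ∧ ((x′ <ᵇ x) ⇔ᵇ (y′ <ᵇ y))

T-agreeᵇ : ∀ x y x′ y′ → T (agreeᵇ x y (x′ , y′)) ⇔ OrderAgrees x y x′ y′
T-agreeᵇ x y x′ y′ = mk⇔
  (λ t → reflect (proj₁ (T-∧⁻ t)) , reflect (proj₂ (T-∧⁻ {(x <ᵇ x′) ⇔ᵇ (y <ᵇ y′)} t)))
  (λ { (a , b) → T-∧⁺ (reify a) (reify b) })
  where
  reflect : ∀ {p q r s} → T ((p <ᵇ q) ⇔ᵇ (r <ᵇ s)) → (p < q ⇔ r < s)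
  reflect {p} {q} {r} {s} t =
    ⇔.trans (⇔.sym (T-<ᵇ p q)) (⇔.trans (Equivalence.to (T-⇔ᵇ _ _) t) (T-<ᵇ r s))
  reify : ∀ {p q r s} → (p < q ⇔ r < s) → T ((p <ᵇ q) ⇔ᵇ (r <ᵇ s))
  reify {p} {q} {r} {s} e =
    Equivalence.from (T-⇔ᵇ _ _) (⇔.trans (T-<ᵇ p q) (⇔.trans e (⇔.sym (T-<ᵇ r s))))

-- not refl: sameOrder compares the pairs through a pattern-matching lambda
sameOrder-∷ : ∀ x y xs ys → sameOrder (x ∷ xs) (y ∷ ys) ≡
  (length xs ≡ᵇ length ys) ∧ allᵇ (agreeᵇ x y) (zip xs ys) ∧ sameOrder xs ys
sameOrder-∷ x y xs ys =
  cong (λ a → (length xs ≡ᵇ length ys) ∧ a ∧ sameOrder xs ys)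
       (allᵇ-cong (λ { (_ , _) → refl }) (zip xs ys))

Pointwise⇒All-zip : ∀ {R : ℕ → ℕ → Set} {xs ys} → Pointwise R xs ys → All (uncurry R) (zip xs ys)
Pointwise⇒All-zip []       = []
Pointwise⇒All-zip (r ∷ rs) = r ∷ Pointwise⇒All-zip rs

All-zip⇒Pointwise : ∀ {R : ℕ → ℕ → Set} xs ys → length xs ≡ length ys →
  All (uncurry R) (zip xs ys) → Pointwise R xs ys
All-zip⇒Pointwise []       []       _ _        = []
All-zip⇒Pointwise (x ∷ xs) (y ∷ ys) l (r ∷ rs) = r ∷ All-zip⇒Pointwise xs ys (suc-injective l) rs

sameOrder⇒SameOrder : ∀ s σ → T (sameOrder s σ) → SameOrder s σ
sameOrder⇒SameOrder []       []       _ = []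
sameOrder⇒SameOrder (x ∷ xs) (y ∷ ys) t rewrite sameOrder-∷ x y xs ys
  with T-∧⁻ t
... | l , t′ with T-∧⁻ {allᵇ (agreeᵇ x y) (zip xs ys)} t′
...   | a , r =
  All-zip⇒Pointwise xs ys (≡ᵇ⇒≡ _ _ l)
    (All.map (Equivalence.to (T-agreeᵇ _ _ _ _)) (allᵇ⇒All _ (zip xs ys) a))
  ∷ sameOrder⇒SameOrder xs ys r

SameOrder⇒sameOrder : ∀ {s σ} → SameOrder s σ → T (sameOrder s σ)
SameOrder⇒sameOrder [] = tt
SameOrder⇒sameOrder {x ∷ xs} {y ∷ ys} (p ∷ o) rewrite sameOrder-∷ x y xs ys =
  T-∧⁺ (≡⇒≡ᵇ _ _ (Pointwise-length p))
    (T-∧⁺ (All⇒allᵇ _ (All.map (Equivalence.from (T-agreeᵇ _ _ _ _)) (Pointwise⇒All-zip p)))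
          (SameOrder⇒sameOrder o))

contains⇒Contains : ∀ π σ → T (contains π σ) → Contains π σ
contains⇒Contains π σ t with find (anyᵇ⇒Any (λ s → sameOrder s σ) (subseqs π) t)
... | s , s∈ , o = s , ∈-subseqs⇒⊆ π s∈ , sameOrder⇒SameOrder s σ o

Contains⇒contains : ∀ {π σ} → Contains π σ → T (contains π σ)
Contains⇒contains {σ = σ} (s , s⊆π , o) =
  Any⇒anyᵇ (λ s → sameOrder s σ) (lose (⊆⇒∈-subseqs s⊆π) (SameOrder⇒sameOrder o))

T-avoids : ∀ π σ → T (avoids π σ) ⇔ (¬ Contains π σ)
T-avoids π σ with contains π σ in eq
... | true  = mk⇔ (λ ()) (λ ¬c → ¬c (contains⇒Contains π σ (subst T (sym eq) tt)))
... | false = mk⇔ (λ _ c → subst T eq (Contains⇒contains c)) _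

InRange : ℕ → ℕ → Set
InRange n x = 0 < x × x ≤ n

IsPermutation : ℕ → List ℕ → Set
IsPermutation n z = length z ≡ n × All (InRange n) z × Unique z

distinct⇒Unique : ∀ z → T (distinct z) → Unique z
distinct⇒Unique []      _ = []
distinct⇒Unique (x ∷ z) t =
  All.map (λ t′ eq → T-not⇒¬T t′ (≡⇒≡ᵇ _ _ eq)) (allᵇ⇒All _ z (proj₁ (T-∧⁻ t)))
  ∷ distinct⇒Unique z (proj₂ (T-∧⁻ {allᵇ (λ y → not (x ≡ᵇ y)) z} t))

Unique⇒distinct : ∀ {z} → Unique z → T (distinct z)
Unique⇒distinct []      = tt
Unique⇒distinct (a ∷ u) =
  T-∧⁺ (All⇒allᵇ _ (All.map (λ x≢y → ¬T⇒T-not (x≢y ∘ ≡ᵇ⇒≡ _ _)) a)) (Unique⇒distinct u)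

∈-words⁻ : ∀ n k {z} → z ∈ words n k → length z ≡ k × All (InRange n) z
∈-words⁻ n zero    (here refl) = refl , []
∈-words⁻ n (suc k) z∈ with find (∈-concatMap⁻ (λ w → map (_∷ w) (oneTo n)) {xs = words n k} z∈)
... | w , w∈ , z∈′ with ∈-map⁻ (_∷ w) z∈′
...   | x , x∈ , refl with ∈-applyUpTo⁻ suc x∈ | ∈-words⁻ n k w∈
...     | i , i<n , refl | l , r = cong suc l , (s≤s z≤n , i<n) ∷ r

∈-words⁺ : ∀ n k {z} → length z ≡ k → All (InRange n) z → z ∈ words n k
∈-words⁺ n zero    {[]}    refl []                  = here refl
∈-words⁺ n (suc k) {x ∷ z} l    ((0<x , x≤n) ∷ r) =
  ∈-concatMap⁺ (λ w → map (_∷ w) (oneTo n)) {xs = words n k}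
    (lose (∈-words⁺ n k (suc-injective l) r) (∈-map⁺ (_∷ z) (∈-oneTo 0<x x≤n)))
  where
  ∈-oneTo : ∀ {x} → 0 < x → x ≤ n → x ∈ oneTo n
  ∈-oneTo {suc i} _ x≤n = ∈-applyUpTo⁺ suc x≤n

∈-SAvoid⁻ : ∀ n R {z} → z ∈ SAvoid n R → IsPermutation n z × All (λ σ → ¬ Contains z σ) R
∈-SAvoid⁻ n R {z} z∈ with ∈-filter⁻ (λ π → T? (allᵇ (avoids π) R)) {xs = S n} z∈
... | z∈S , t with ∈-filter⁻ (λ π → T? (distinct π)) {xs = words n n} z∈S
...   | z∈words , d with ∈-words⁻ n n z∈words
...     | l , r = (l , r , distinct⇒Unique z d) ,
                  All.map (Equivalence.to (T-avoids z _)) (allᵇ⇒All (avoids z) R t)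

∈-SAvoid⁺ : ∀ n R {z} → IsPermutation n z → All (λ σ → ¬ Contains z σ) R → z ∈ SAvoid n R
∈-SAvoid⁺ n R {z} (l , r , u) av =
  ∈-filter⁺ (λ π → T? (allᵇ (avoids π) R))
    (∈-filter⁺ (λ π → T? (distinct π)) (∈-words⁺ n n l r) (Unique⇒distinct u))
    (All⇒allᵇ (avoids z) (All.map (Equivalence.from (T-avoids z _)) av))

Unique-oneTo : ∀ n → Unique (oneTo n)
Unique-oneTo n = Unique.applyUpTo⁺₁ suc n (λ i<j _ → <⇒≢ i<j ∘ suc-injective)

Unique-words : ∀ n k → Unique (words n k)
Unique-words n zero    = [] ∷ []
Unique-words n (suc k) =
  Unique.concat⁺
    (All-map⁺ (All.tabulate (λ _ → Unique.map⁺ (proj₁ ∘ ∷-injective) (Unique-oneTo n))))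
    (AllPairs.map⁺ (AllPairs.map disjoint (Unique-words n k)))
  where
  disjoint : ∀ {w w′} → w ≢ w′ → Disjoint (map (_∷ w) (oneTo n)) (map (_∷ w′) (oneTo n))
  disjoint w≢w′ (z∈ , z∈′) with ∈-map⁻ _ z∈ | ∈-map⁻ _ z∈′
  ... | _ , _ , refl | _ , _ , eq = w≢w′ (proj₂ (∷-injective eq))

Unique-SAvoid : ∀ n R → Unique (SAvoid n R)
Unique-SAvoid n R =
  Unique.filter⁺ (λ π → T? (allᵇ (avoids π) R))
    (Unique.filter⁺ (λ π → T? (distinct π)) (Unique-words n n))

below⇒ : ∀ {x y x′ y′} → y′ < y → OrderAgrees x y x′ y′ → x′ < x
below⇒ y′<y (_ , e) = Equivalence.from e y′<y

below⇐ : ∀ {x y x′ y′} → y′ < y → x′ < x → OrderAgrees x y x′ y′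
below⇐ y′<y x′<x =
  mk⇔ (λ x<x′ → ⊥-elim (<-asym x<x′ x′<x)) (λ y<y′ → ⊥-elim (<-asym y<y′ y′<y)) ,
  mk⇔ (λ _ → y′<y) (λ _ → x′<x)

above⇒ : ∀ {x y x′ y′} → y < y′ → OrderAgrees x y x′ y′ → x < x′
above⇒ y<y′ (e , _) = Equivalence.from e y<y′

above⇐ : ∀ {x y x′ y′} → y < y′ → x < x′ → OrderAgrees x y x′ y′
above⇐ y<y′ x<x′ =
  mk⇔ (λ _ → y<y′) (λ _ → x<x′) ,
  mk⇔ (λ x′<x → ⊥-elim (<-asym x<x′ x′<x)) (λ y′<y → ⊥-elim (<-asym y<y′ y′<y))

Pointwise-below⇒ : ∀ {x y xs ys} → Pointwise (OrderAgrees x y) xs ys → All (_< y) ys → All (_< x) xs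
Pointwise-below⇒ []       []         = []
Pointwise-below⇒ (a ∷ as) (y′<y ∷ ys) = below⇒ y′<y a ∷ Pointwise-below⇒ as ys

Pointwise-below⇐ : ∀ {x y xs ys} → length xs ≡ length ys →
  All (_< x) xs → All (_< y) ys → Pointwise (OrderAgrees x y) xs ys
Pointwise-below⇐ {xs = []}    {[]}    _ [] []                  = []
Pointwise-below⇐ {xs = _ ∷ _} {_ ∷ _} l (x′<x ∷ xs) (y′<y ∷ ys) =
  below⇐ y′<y x′<x ∷ Pointwise-below⇐ (suc-injective l) xs ys

Pointwise-++⁻ : ∀ {R : ℕ → ℕ → Set} ws {ys} xs {zs} → length ws ≡ length xs →
  Pointwise R (ws ++ ys) (xs ++ zs) → Pointwise R ws xs × Pointwise R ys zs
Pointwise-++⁻ []       []       _ p       = [] , p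
Pointwise-++⁻ (w ∷ ws) (x ∷ xs) l (r ∷ p) with Pointwise-++⁻ ws xs (suc-injective l) p
... | p₁ , p₂ = r ∷ p₁ , p₂

All<-weaken : ∀ {a b xs} → a ≤ b → All (_< a) xs → All (_< b) xs
All<-weaken a≤b = All.map (λ x<a → <-≤-trans x<a a≤b)

Decreasing : List ℕ → Set
Decreasing = AllPairs _>_

AllAbove : List ℕ → List ℕ → Set
AllAbove d e = All (λ x → All (_< x) e) d

length-desc : ∀ lo k → length (desc lo k) ≡ k
length-desc lo zero    = refl
length-desc lo (suc k) = cong suc (length-desc lo k)

desc-< : ∀ lo k → All (_< lo + k) (desc lo k)
desc-< lo zero    = []
desc-< lo (suc k) = lo+k<lo+1+k ∷ All<-weaken (<⇒≤ lo+k<lo+1+k) (desc-< lo k)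
  where lo+k<lo+1+k = +-monoʳ-< lo (n<1+n k)

desc-≥ : ∀ lo k → All (lo ≤_) (desc lo k)
desc-≥ lo zero    = []
desc-≥ lo (suc k) = m≤m+n lo k ∷ desc-≥ lo k

desc-decreasing : ∀ lo k → Decreasing (desc lo k)
desc-decreasing lo zero    = []
desc-decreasing lo (suc k) = desc-< lo k ∷ desc-decreasing lo k

SameOrder-desc⇒ : ∀ lo k {s} → SameOrder s (desc lo k) → length s ≡ k × Decreasing s
SameOrder-desc⇒ lo zero    []      = refl , []
SameOrder-desc⇒ lo (suc k) (p ∷ o) with SameOrder-desc⇒ lo k o
... | l , d = cong suc l , Pointwise-below⇒ p (desc-< lo k) ∷ d

SameOrder-desc⇐ : ∀ lo k {s} → length s ≡ k → Decreasing s → SameOrder s (desc lo k)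
SameOrder-desc⇐ lo zero    {[]}    _ _        = []
SameOrder-desc⇐ lo (suc k) {_ ∷ s} l (a ∷ d) =
  Pointwise-below⇐ (trans (suc-injective l) (sym (length-desc lo k))) a (desc-< lo k)
  ∷ SameOrder-desc⇐ lo k (suc-injective l) d

data ΓShape (b c : ℕ) : List ℕ → Set where
  shape : ∀ d m e → length d ≡ b → length e ≡ c → Decreasing d → Decreasing e →
          All (_< m) d → All (_< m) e → AllAbove d e → ΓShape b c (d ++ m ∷ e)

-- γ 0 b c is the instance lo = c + 1, M = b + c + 1 of the pattern below
SameOrder-Γ⇒ : ∀ lo M b c {s} → c < lo → lo + b ≤ M →
  SameOrder s (desc lo b ++ M ∷ desc 1 c) → ΓShape b c s
SameOrder-Γ⇒ lo M zero c c<lo lo≤M (p ∷ o) with SameOrder-desc⇒ 1 c o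
... | le , de =
  shape [] _ _ refl le [] de []
    (Pointwise-below⇒ p (All<-weaken (≤-trans c<lo (≤-trans (m≤m+n lo 0) lo≤M)) (desc-< 1 c))) []
SameOrder-Γ⇒ lo M (suc b) c c<lo lo+b<M (p ∷ o) =
  extend (SameOrder-Γ⇒ lo M b c c<lo (≤-trans (+-monoʳ-≤ lo (n≤1+n b)) lo+b<M) o) p
  where
  extend : ∀ {x s} → ΓShape b c s → Pointwise (OrderAgrees x (lo + b)) s (desc lo b ++ M ∷ desc 1 c) →
           ΓShape (suc b) c (x ∷ s)
  extend (shape d m e ld le dd de dm em d≻e) p
    with Pointwise-++⁻ d (desc lo b) (trans ld (sym (length-desc lo b))) p
  ... | pd , (pm ∷ pe) =
    shape (_ ∷ d) m e (cong suc ld) le (Pointwise-below⇒ pd (desc-< lo b) ∷ dd) de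
      (above⇒ (subst (_≤ M) (+-suc lo b) lo+b<M) pm ∷ dm) em
      (Pointwise-below⇒ pe (All<-weaken (≤-trans c<lo (m≤m+n lo b)) (desc-< 1 c)) ∷ d≻e)

SameOrder-Γ⇐ : ∀ lo M b c {s} → c < lo → lo + b ≤ M →
  ΓShape b c s → SameOrder s (desc lo b ++ M ∷ desc 1 c)
SameOrder-Γ⇐ lo M zero c c<lo lo≤M (shape [] m e refl le [] de [] em []) =
  Pointwise-below⇐ (trans le (sym (length-desc 1 c))) em
    (All<-weaken (≤-trans c<lo (≤-trans (m≤m+n lo 0) lo≤M)) (desc-< 1 c))
  ∷ SameOrder-desc⇐ 1 c le de
SameOrder-Γ⇐ lo M (suc b) c c<lo lo+b<M
  (shape (x ∷ d) m e ld le (xd ∷ dd) de (xm ∷ dm) em (xe ∷ d≻e)) =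
  Pointwise.++⁺ (Pointwise-below⇐ ld′ xd (desc-< lo b))
    (above⇐ (subst (_≤ M) (+-suc lo b) lo+b<M) xm
     ∷ Pointwise-below⇐ (trans le (sym (length-desc 1 c))) xe
         (All<-weaken (≤-trans c<lo (m≤m+n lo b)) (desc-< 1 c)))
  ∷ SameOrder-Γ⇐ lo M b c c<lo (≤-trans (+-monoʳ-≤ lo (n≤1+n b)) lo+b<M)
      (shape d m e (suc-injective ld) le dd de dm em d≻e)
  where ld′ = trans (suc-injective ld) (sym (length-desc lo b))

γ-bounds : ∀ b c → c < c + 1 × (c + 1) + b ≤ b + c + 1
γ-bounds b c = m<m+n c z<s , ≤-reflexive (trans (+-comm (c + 1) b) (sym (+-assoc b c 1)))

SameOrder-γ⇒ : ∀ b c {s} → SameOrder s (γ 0 b c) → ΓShape b c s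
SameOrder-γ⇒ b c = let c<lo , lo+b≤M = γ-bounds b c in SameOrder-Γ⇒ (c + 1) (b + c + 1) b c c<lo lo+b≤M

SameOrder-γ⇐ : ∀ b c {s} → ΓShape b c s → SameOrder s (γ 0 b c)
SameOrder-γ⇐ b c = let c<lo , lo+b≤M = γ-bounds b c in SameOrder-Γ⇐ (c + 1) (b + c + 1) b c c<lo lo+b≤M

SameOrder-δ⇒ : ∀ c {s} → SameOrder s (γ 0 0 c) → length s ≡ suc c × Decreasing s
SameOrder-δ⇒ c o with SameOrder-γ⇒ 0 c o
... | shape [] m e refl le [] de [] em [] = cong suc le , em ∷ de

SameOrder-δ⇐ : ∀ c {s} → length s ≡ suc c → Decreasing s → SameOrder s (γ 0 0 c)
SameOrder-δ⇐ c {m ∷ e} l (em ∷ de) =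
  SameOrder-γ⇐ 0 c (shape [] m e refl (suc-injective l) [] de [] em [])

MinFirstTriple : List ℕ → Set
MinFirstTriple s = ∃[ x ] ∃[ y ] ∃[ w ] s ≡ x ∷ y ∷ w ∷ [] × x < y × x < w

SameOrder-123⇒ : ∀ {s} → SameOrder s p123 → MinFirstTriple s
SameOrder-123⇒ ((a ∷ b ∷ []) ∷ _) = _ , _ , _ , refl , above⇒ (s<s z<s) a , above⇒ (s<s z<s) b

SameOrder-132⇒ : ∀ {s} → SameOrder s p132 → MinFirstTriple s
SameOrder-132⇒ ((a ∷ b ∷ []) ∷ _) = _ , _ , _ , refl , above⇒ (s<s z<s) a , above⇒ (s<s z<s) b

SameOrder-123⇐ : ∀ {x y w} → x < y → y < w → SameOrder (x ∷ y ∷ w ∷ []) p123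
SameOrder-123⇐ x<y y<w =
  (above⇐ (s<s z<s) x<y ∷ above⇐ (s<s z<s) (<-trans x<y y<w) ∷ [])
  ∷ (above⇐ (s<s (s<s z<s)) y<w ∷ []) ∷ [] ∷ []

SameOrder-132⇐ : ∀ {x y w} → x < w → w < y → SameOrder (x ∷ y ∷ w ∷ []) p132
SameOrder-132⇐ x<w w<y =
  (above⇐ (s<s z<s) (<-trans x<w w<y) ∷ above⇐ (s<s z<s) x<w ∷ [])
  ∷ (below⇐ (s<s (s<s z<s)) w<y ∷ []) ∷ [] ∷ []

AllPairs-resp-⊆ : ∀ {R : ℕ → ℕ → Set} {s t} → s ⊆ t → AllPairs R t → AllPairs R s
AllPairs-resp-⊆ []       []       = []
AllPairs-resp-⊆ (refl ∷ τ) (a ∷ r) = All-resp-⊆ τ a ∷ AllPairs-resp-⊆ τ r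
AllPairs-resp-⊆ (_ ∷ʳ τ) (_ ∷ r) = AllPairs-resp-⊆ τ r

head-resp-⊆ : ∀ {P : ℕ → Set} {y s t} → y ∷ s ⊆ t → All P t → P y
head-resp-⊆ τ ps = All.head (All-resp-⊆ τ ps)

sublist-of-length : ∀ k (p : List ℕ) → k ≤ length p → ∃[ d ] d ⊆ p × length d ≡ k
sublist-of-length zero    p       _         = [] , minimum p , refl
sublist-of-length (suc k) (x ∷ p) (s≤s k≤p) with sublist-of-length k p k≤p
... | d , τ , l = x ∷ d , refl ∷ τ , cong suc l

⊆-split : ∀ a x b {z} → a ++ x ∷ b ⊆ z →
  Σ[ z₁ ∈ List ℕ ] Σ[ z₂ ∈ List ℕ ] z ≡ z₁ ++ x ∷ z₂ × a ⊆ z₁ × b ⊆ z₂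
⊆-split []      x b {_ ∷ z} (refl ∷ τ) = [] , z , refl , [] , τ
⊆-split a       x b (y ∷ʳ τ) with ⊆-split a x b τ
... | z₁ , z₂ , refl , σ , ρ = y ∷ z₁ , z₂ , refl , y ∷ʳ σ , ρ
⊆-split (y ∷ a) x b (refl ∷ τ) with ⊆-split a x b τ
... | z₁ , z₂ , refl , σ , ρ = y ∷ z₁ , z₂ , refl , refl ∷ σ , ρ

⊆-dropˡ : ∀ {M s b} a → All (_< M) s → All (M <_) a → s ⊆ a ++ b → s ⊆ b
⊆-dropˡ []      _          _          τ          = τ
⊆-dropˡ (_ ∷ a) (x<M ∷ _)  (M<y ∷ _)  (refl ∷ τ) = ⊥-elim (<-asym x<M M<y)
⊆-dropˡ (_ ∷ a) s<M        (_ ∷ M<a)  (_ ∷ʳ τ)   = ⊆-dropˡ a s<M M<a τ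

++-∷-cases : ∀ (z₁ : List ℕ) M z₂ p t v → z₁ ++ M ∷ z₂ ≡ p ++ t ∷ v →
    (∃[ q ] p ≡ z₁ ++ M ∷ q × z₂ ≡ q ++ t ∷ v)
  ⊎ (z₁ ≡ p × M ≡ t × z₂ ≡ v)
  ⊎ (∃[ r ] z₁ ≡ p ++ t ∷ r × v ≡ r ++ M ∷ z₂)
++-∷-cases []       M z₂ []      t v refl = inj₂ (inj₁ (refl , refl , refl))
++-∷-cases []       M z₂ (_ ∷ p) t v refl = inj₁ (p , refl , refl)
++-∷-cases (_ ∷ z₁) M z₂ []      t v refl = inj₂ (inj₂ (z₁ , refl , refl))
++-∷-cases (_ ∷ z₁) M z₂ (_ ∷ p) t v eq with ∷-injective eq
... | refl , eq′ with ++-∷-cases z₁ M z₂ p t v eq′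
...   | inj₁ (q , refl , refl)           = inj₁ (q , refl , refl)
...   | inj₂ (inj₁ (refl , refl , refl)) = inj₂ (inj₁ (refl , refl , refl))
...   | inj₂ (inj₂ (r , refl , refl))    = inj₂ (inj₂ (r , refl , refl))

AllPairs-before : ∀ {R : ℕ → ℕ → Set} xs {y ys} → AllPairs R (xs ++ y ∷ ys) → All (λ x → R x y) xs
AllPairs-before []       _       = []
AllPairs-before (x ∷ xs) (a ∷ r) = All.head (++⁻ʳ xs a) ∷ AllPairs-before xs r

++-∷-injective : ∀ {t} p p′ {v v′} → All (_< t) p → All (_< t) p′ → p ++ t ∷ v ≡ p′ ++ t ∷ v′ →
  p ≡ p′ × v ≡ v′
++-∷-injective []      []       _          _           eq = refl , proj₂ (∷-injective eq)
++-∷-injective []      (_ ∷ _)  _         (t<t ∷ _) eq = ⊥-elim (<-irrefl (sym (proj₁ (∷-injective eq))) t<t)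
++-∷-injective (_ ∷ _) []       (t<t ∷ _) _         eq = ⊥-elim (<-irrefl (proj₁ (∷-injective eq)) t<t)
++-∷-injective (x ∷ p) (x′ ∷ p′) (_ ∷ p<t) (_ ∷ p′<t) eq with ∷-injective eq
... | refl , eq′ with ++-∷-injective p p′ p<t p′<t eq′
...   | refl , refl = refl , refl

record Stacked (p : List ℕ) (t : ℕ) (v : List ℕ) : Set where
  field
    p-decreasing : Decreasing p
    p<t          : All (_< t) p
    p≻v          : AllAbove p v
    v<t          : All (_< t) v

desc-stacked : ∀ m j v → All (_< suc m) v → Stacked (desc (suc m) j) (suc (m + j)) v
desc-stacked m j v v≤m = record
  { p-decreasing = desc-decreasing (suc m) j
  ; p<t          = desc-< (suc m) j
  ; p≻v          = All.map (λ m<x → All<-weaken m<x v≤m) (desc-≥ (suc m) j)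
  ; v<t          = All<-weaken (s≤s (m≤m+n m j)) v≤m
  }

Contains-tail : ∀ {σ} p t v → Contains v σ → Contains (p ++ t ∷ v) σ
Contains-tail p t v (s , τ , o) = s , ⊆-trans τ (++⁺ˡ p (t ∷ʳ ⊆-refl)) , o

avoids-tail : ∀ {σ} p t v → ¬ Contains (p ++ t ∷ v) σ → ¬ Contains v σ
avoids-tail p t v ¬c = ¬c ∘ Contains-tail p t v

two-above-impossible : ∀ {q y w t} p v → All (_< q) p → All (_< q) v → q < y → q < w →
  ¬ (y ∷ w ∷ [] ⊆ p ++ t ∷ v)
two-above-impossible (_ ∷ p) v (a<q ∷ _) _  q<y _   (refl ∷ _) = <-asym a<q q<y
two-above-impossible (_ ∷ p) v (_ ∷ p<q) v<q q<y q<w (_ ∷ʳ τ)   = two-above-impossible p v p<q v<q q<y q<w τ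
two-above-impossible []      v _ v<q _   q<w (refl ∷ τ) = <-asym (head-resp-⊆ τ v<q) q<w
two-above-impossible []      v _ v<q q<y _   (_ ∷ʳ τ)   = <-asym (head-resp-⊆ τ v<q) q<y

minFirst-⊆-tail : ∀ {p t v s} → Stacked p t v → MinFirstTriple s → s ⊆ p ++ t ∷ v → s ⊆ v
minFirst-⊆-tail {p} {t} {v} st (x , y , w , refl , x<y , x<w) = go p (p-decreasing st) (p≻v st)
  where
  open Stacked
  go : ∀ p → Decreasing p → AllAbove p v → x ∷ y ∷ w ∷ [] ⊆ p ++ t ∷ v → x ∷ y ∷ w ∷ [] ⊆ v
  go (_ ∷ p) (a>p ∷ _) (a>v ∷ _) (refl ∷ τ) = ⊥-elim (two-above-impossible p v a>p a>v x<y x<w τ)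
  go (_ ∷ p) (_ ∷ dp)  (_ ∷ p≻v) (_ ∷ʳ τ)   = go p dp p≻v τ
  go []      _         _         (refl ∷ τ) = ⊥-elim (<-asym x<y (head-resp-⊆ τ (v<t st)))
  go []      _         _         (_ ∷ʳ τ)   = τ

Stacked-avoids : ∀ {σ p t v} → (∀ {s} → SameOrder s σ → MinFirstTriple s) →
  Stacked p t v → ¬ Contains v σ → ¬ Contains (p ++ t ∷ v) σ
Stacked-avoids minFirst st v-avoids (s , τ , o) = v-avoids (s , minFirst-⊆-tail st (minFirst o) τ , o)

HasDecreasing : List ℕ → ℕ → Set
HasDecreasing v k = ∃[ e ] e ⊆ v × Decreasing e × length e ≡ k

Contains-δ⇒ : ∀ c {v} → Contains v (γ 0 0 c) → HasDecreasing v (suc c)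
Contains-δ⇒ c (s , τ , o) with SameOrder-δ⇒ c o
... | l , d = s , τ , d , l

Contains-δ⇐ : ∀ c {v} → HasDecreasing v (suc c) → Contains v (γ 0 0 c)
Contains-δ⇐ c (e , τ , d , l) = e , τ , SameOrder-δ⇐ c l d

Contains-γ⇒HasDecreasing : ∀ b c {v} → Contains v (γ 0 b c) → HasDecreasing v c
Contains-γ⇒HasDecreasing b c (s , τ , o) with SameOrder-γ⇒ b c o
... | shape d m e _ le _ de _ _ _ = e , ⊆-trans (++⁺ˡ d (m ∷ʳ ⊆-refl)) τ , de , le

module _ {p t v} (st : Stacked p t v) where
  open Stacked st

  -- The peak M of an occurrence d ++ M ∷ e cannot lie in p, as d would precede it in the
  -- decreasing run p; if M is t then d ⊆ p and e ⊆ v, and if M lies in v then so does all of d.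
  Stacked-contains-γ⇒ : ∀ b c → Contains (p ++ t ∷ v) (γ 0 (suc b) c) →
    (suc b ≤ length p × HasDecreasing v c) ⊎ Contains v (γ 0 (suc b) c)
  Stacked-contains-γ⇒ b c (s , τ , o) = locate (SameOrder-γ⇒ (suc b) c o) τ o
    where
    locate : ∀ {s} → ΓShape (suc b) c s → s ⊆ p ++ t ∷ v → SameOrder s (γ 0 (suc b) c) →
      (suc b ≤ length p × HasDecreasing v c) ⊎ Contains v (γ 0 (suc b) c)
    locate (shape (x ∷ d) M e ld le _ de (x<M ∷ d<M) _ _) τ o with ⊆-split (x ∷ d) M e τ
    ... | z₁ , z₂ , eq , τ₁ , τ₂ with ++-∷-cases z₁ M z₂ p t v (sym eq)
    ...   | inj₁ (q , refl , refl) =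
      ⊥-elim (<-asym x<M (head-resp-⊆ τ₁ (AllPairs-before z₁ p-decreasing)))
    ...   | inj₂ (inj₁ (refl , refl , refl)) =
      inj₁ (subst (_≤ length p) ld (length-mono-≤ τ₁) , e , τ₂ , de , le)
    ...   | inj₂ (inj₂ (r , refl , refl)) =
      inj₂ (x ∷ d ++ M ∷ e ,
            ++⁺ (⊆-dropˡ (t ∷ []) (x<M ∷ d<M) (M<t ∷ []) (⊆-dropˡ p (x<M ∷ d<M) M<p τ₁)) (refl ∷ τ₂) , o)
      where
      M<p : All (M <_) p
      M<p = All.map (λ a>v → All.head (++⁻ʳ r a>v)) p≻v
      M<t : M < t
      M<t = All.head (++⁻ʳ r v<t)

  Stacked-contains-γ⇐ : ∀ b c → (b ≤ length p × HasDecreasing v c) ⊎ Contains v (γ 0 b c) →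
    Contains (p ++ t ∷ v) (γ 0 b c)
  Stacked-contains-γ⇐ b c (inj₂ o) = Contains-tail p t v o
  Stacked-contains-γ⇐ b c (inj₁ (b≤p , e , τe , de , le)) with sublist-of-length b p b≤p
  ... | d , τd , ld =
    d ++ t ∷ e , ++⁺ τd (refl ∷ τe) ,
    SameOrder-γ⇐ b c (shape d t e ld le (AllPairs-resp-⊆ τd p-decreasing) de (All-resp-⊆ τd p<t)
      (All-resp-⊆ τe v<t) (All.map (All-resp-⊆ τe) (All-resp-⊆ τd p≻v)))

Stacked-unique : ∀ {p t v} → Stacked p t v → Unique v → Unique (p ++ t ∷ v)
Stacked-unique st u = AllPairs.++⁺ (AllPairs.map (λ y<x x≡y → <-irrefl (sym x≡y) y<x) p-decreasing)
  (All.map (λ w<t t≡w → <-irrefl (sym t≡w) w<t) v<t ∷ u)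
  (All.zipWith (λ (x<t , v<x) → (λ x≡t → <-irrefl x≡t x<t) ∷ All.map (λ w<x x≡w → <-irrefl (sym x≡w) w<x) v<x)
    (p<t , p≻v))
  where open Stacked st

without : ℕ → List ℕ → List ℕ
without a = filter (λ x → ¬? (x ≟ a))

length-without : ∀ a xs → Unique xs → length xs ≤ suc (length (without a xs))
length-without a []       _          = z≤n
length-without a (x ∷ xs) (x∉xs ∷ u) with x ≟ a
... | yes refl rewrite filter-reject (λ x → ¬? (x ≟ a)) {xs = xs} (λ x≢x → x≢x refl)
                     | filter-all (λ x → ¬? (x ≟ a)) (All.map (_∘ sym) x∉xs) = ≤-refl
... | no x≢a  rewrite filter-accept (λ x → ¬? (x ≟ a)) {xs = xs} x≢a = s≤s (length-without a xs u)

InRange-pred : ∀ {B x} → InRange (suc B) x → x ≢ suc B → InRange B x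
InRange-pred (0<x , x≤1+B) x≢1+B = 0<x , ≤-pred (≤∧≢⇒< x≤1+B x≢1+B)

pigeonhole : ∀ B xs → Unique xs → All (InRange B) xs → length xs ≤ B
pigeonhole zero    []       _ _                  = z≤n
pigeonhole zero    (_ ∷ _)  _ ((0<x , x≤0) ∷ _) = ⊥-elim (<⇒≱ 0<x x≤0)
pigeonhole (suc B) xs       u r =
  ≤-trans (length-without (suc B) xs u)
    (s≤s (pigeonhole B ys (AllPairs-resp-⊆ ys⊆xs u)
      (All.zipWith (λ (x-range , x≢1+B) → InRange-pred x-range x≢1+B)
        (All-resp-⊆ ys⊆xs r , all-filter (λ x → ¬? (x ≟ suc B)) xs))))
  where
  ys = without (suc B) xs
  ys⊆xs = filter-⊆ (λ x → ¬? (x ≟ suc B)) xs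

maximum-∈ : ∀ n {z} → IsPermutation (suc n) z → suc n ∈ z
maximum-∈ n {z} (l , r , u) with suc n ∈? z
... | yes n+1∈z = n+1∈z
... | no  n+1∉z = ⊥-elim (1+n≰n (subst (_≤ n) l (pigeonhole n z u
        (All.zipWith (λ (x-range , 1+n≢x) → InRange-pred x-range (1+n≢x ∘ sym))
          (r , ¬Any⇒All¬ z n+1∉z)))))

avoider-stacked : ∀ p t v → Unique (p ++ t ∷ v) → All (_< t) p → All (_< t) v →
  ¬ Contains (p ++ t ∷ v) p123 → ¬ Contains (p ++ t ∷ v) p132 → Stacked p t v
avoider-stacked p t v u p<t v<t ¬123 ¬132 = record
  { p-decreasing = decreasing p u p<t ¬123 ; p<t = p<t ; p≻v = above p u ¬132 ; v<t = v<t }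
  where
  decreasing : ∀ p → Unique (p ++ t ∷ v) → All (_< t) p → ¬ Contains (p ++ t ∷ v) p123 → Decreasing p
  decreasing []      _          _           _    = []
  decreasing (a ∷ p) (a∉ ∷ u) (_ ∷ p<t) ¬123 =
    All.tabulate (λ {b} b∈p → ≤∧≢⇒< (≮⇒≥ (λ a<b → ¬123
        (a ∷ b ∷ t ∷ [] , refl ∷ ++⁺ (from∈ b∈p) (refl ∷ minimum v) ,
         SameOrder-123⇐ a<b (All.lookup p<t b∈p))))
      (λ b≡a → All.lookup (++⁻ˡ p a∉) b∈p (sym b≡a)))
    ∷ decreasing p u p<t (λ (s , τ , o) → ¬123 (s , a ∷ʳ τ , o))
  above : ∀ p → Unique (p ++ t ∷ v) → ¬ Contains (p ++ t ∷ v) p132 → AllAbove p v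
  above []      _          _    = []
  above (a ∷ p) (a∉ ∷ u) ¬132 =
    All.tabulate (λ {w} w∈v → ≤∧≢⇒< (≮⇒≥ (λ a<w → ¬132
        (a ∷ t ∷ w ∷ [] , refl ∷ ++⁺ˡ p (refl ∷ from∈ w∈v) ,
         SameOrder-132⇐ a<w (All.lookup v<t w∈v))))
      (λ w≡a → All.lookup (All.tail (++⁻ʳ p a∉)) w∈v (sym w≡a)))
    ∷ above p u (λ (s , τ , o) → ¬132 (s , a ∷ʳ τ , o))

decreasing-head-≥ : ∀ lo h p → Decreasing (h ∷ p) → All (lo ≤_) (h ∷ p) → lo + length p ≤ h
decreasing-head-≥ lo h []       _                (lo≤h ∷ _)          = subst (_≤ h) (sym (+-identityʳ lo)) lo≤h
decreasing-head-≥ lo h (h′ ∷ p) ((h′<h ∷ _) ∷ d) (_ ∷ lo≤h′ ∷ lo≤p) = begin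
  lo + suc (length p)  ≡⟨ +-suc lo (length p) ⟩
  suc (lo + length p)  ≤⟨ s≤s (decreasing-head-≥ lo h′ p d (lo≤h′ ∷ lo≤p)) ⟩
  suc h′               ≤⟨ h′<h ⟩
  h                    ∎
  where open ≤-Reasoning

decreasing-in-range⇒desc : ∀ lo j p → Decreasing p → length p ≡ j →
  All (lo ≤_) p → All (_< lo + j) p → p ≡ desc lo j
decreasing-in-range⇒desc lo zero    []      _         _ _ _ = refl
decreasing-in-range⇒desc lo (suc j) (h ∷ p) (h>p ∷ d) l (lo≤h ∷ lo≤p) (h<lo+1+j ∷ _) =
  cong₂ _∷_ h≡lo+j
    (decreasing-in-range⇒desc lo j p d (suc-injective l) lo≤p
      (All<-weaken (≤-reflexive h≡lo+j) h>p))
  where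
  h≡lo+j : h ≡ lo + j
  h≡lo+j = ≤-antisym (≤-pred (subst (h <_) (+-suc lo j) h<lo+1+j))
             (subst (λ k → lo + k ≤ h) (suc-injective l)
               (decreasing-head-≥ lo h p (h>p ∷ d) (lo≤h ∷ lo≤p)))

stack : ℕ → ℕ → List ℕ → List ℕ
stack j m v = desc (suc m) j ++ suc (m + j) ∷ v

below-desc⇒below-lo : ∀ lo j {w} → All (w <_) (desc lo j) → w < lo + j → w < lo
below-desc⇒below-lo lo zero    {w} _               w<lo+0 = subst (w <_) (+-identityʳ lo) w<lo+0
below-desc⇒below-lo lo (suc j)     (w<lo+j ∷ w<d) _      = below-desc⇒below-lo lo j w<d w<lo+j

avoider-split-at-maximum : ∀ n {z} → IsPermutation (suc n) z → ¬ Contains z p123 → ¬ Contains z p132 →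
  ∃[ p ] ∃[ v ] z ≡ p ++ suc n ∷ v × Stacked p (suc n) v
avoider-split-at-maximum n perm@(_ , r , u) ¬123 ¬132 with ∈-∃++ (maximum-∈ n perm)
... | p , v , refl = p , v , refl , avoider-stacked p (suc n) v u p<t v<t ¬123 ¬132
  where
  p<t = All.zipWith (λ { ((_ , x≤t) , x≢t) → ≤∧≢⇒< x≤t x≢t }) (++⁻ˡ p r , AllPairs-before p u)
  v<t = All.zipWith (λ { ((_ , w≤t) , t≢w) → ≤∧≢⇒< w≤t (t≢w ∘ sym) })
          (All.tail (++⁻ʳ p r) , AllPairs.head (AllPairs-resp-⊆ (++⁺ˡ p ⊆-refl) u))

stacked-permutation-is-stack : ∀ n p v → IsPermutation (suc n) (p ++ suc n ∷ v) → Stacked p (suc n) v →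
  length v + length p ≡ n × p ≡ desc (suc (length v)) (length p) × IsPermutation (length v) v
stacked-permutation-is-stack n p v (l , r , u) st = m+j≡n , p≡desc , (refl , v-range , u-v)
  where
  open Stacked st
  m = length v
  j = length p
  r-v = All.tail (++⁻ʳ p r)
  u-v = AllPairs-resp-⊆ (++⁺ˡ p (_ ∷ʳ ⊆-refl)) u
  m+j≡n : m + j ≡ n
  m+j≡n = begin
    m + j      ≡⟨ +-comm m j ⟩
    j + m      ≡⟨ suc-injective (trans (sym (+-suc j m)) (trans (sym (length-++ p)) l)) ⟩
    n          ∎
    where open ≡-Reasoning
  p≥1+m : All (suc m ≤_) p
  p≥1+m = All.zipWith (λ { {suc x} ((_ , _) , v<x) →
            s≤s (pigeonhole x v u-v
              (All.zipWith (λ { ((0<w , _) , w<x) → 0<w , ≤-pred w<x }) (r-v , v<x))) })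
          (++⁻ˡ p r , p≻v)
  p≡desc : p ≡ desc (suc m) j
  p≡desc = decreasing-in-range⇒desc (suc m) j p p-decreasing refl p≥1+m
             (subst (λ k → All (_< suc k) p) (sym m+j≡n) p<t)
  v-range : All (InRange m) v
  v-range = All.zipWith (λ { ((0<w , _) , w<1+m) → 0<w , ≤-pred w<1+m })
    (r-v , All.tabulate (λ {w} w∈v → below-desc⇒below-lo (suc m) j
      (subst (All (w <_)) p≡desc (All.map (λ w<a → All.lookup w<a w∈v) p≻v))
      (subst (λ k → w < suc k) (sym m+j≡n) (All.lookup v<t w∈v))))

avoider-decomposition : ∀ n {z} → IsPermutation (suc n) z → ¬ Contains z p123 → ¬ Contains z p132 →
  ∃[ m ] ∃[ j ] ∃[ v ] m + j ≡ n × z ≡ stack j m v × IsPermutation m v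
avoider-decomposition n perm ¬123 ¬132 with avoider-split-at-maximum n perm ¬123 ¬132
... | p , v , refl , st with stacked-permutation-is-stack n p v perm st
...   | m+j≡n , p≡desc , perm-v =
  length v , length p , v , m+j≡n , cong₂ _++_ p≡desc (cong (λ k → suc k ∷ v) (sym m+j≡n)) , perm-v

stack-stacked : ∀ j m {v} → All (InRange m) v → Stacked (desc (suc m) j) (suc (m + j)) v
stack-stacked j m r = desc-stacked m j _ (All.map (s≤s ∘ proj₂) r)

stack-permutation : ∀ j m {v} → IsPermutation m v → IsPermutation (suc (m + j)) (stack j m v)
stack-permutation j m {v} (l , r , u) = len , range , Stacked-unique (stack-stacked j m r) u
  where
  len : length (stack j m v) ≡ suc (m + j)
  len = begin
    length (desc (suc m) j ++ suc (m + j) ∷ v)  ≡⟨ length-++ (desc (suc m) j) ⟩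
    length (desc (suc m) j) + suc (length v)    ≡⟨ cong₂ (λ a b → a + suc b) (length-desc (suc m) j) l ⟩
    j + suc m                                   ≡⟨ +-suc j m ⟩
    suc (j + m)                                 ≡⟨ cong suc (+-comm j m) ⟩
    suc (m + j)                                 ∎
    where open ≡-Reasoning
  range : All (InRange (suc (m + j))) (stack j m v)
  range = All-++⁺
    (All.zipWith (λ (m<x , x<t) → <-≤-trans z<s m<x , <⇒≤ x<t) (desc-≥ (suc m) j , desc-< (suc m) j))
    ((z<s , ≤-refl) ∷ All.map (λ (0<w , w≤m) → 0<w , m≤n⇒m≤1+n (≤-trans w≤m (m≤m+n m j))) r)

stack-injective : ∀ {j m v j′ m′ v′} → m + j ≡ m′ + j′ → stack j m v ≡ stack j′ m′ v′ →
  j ≡ j′ × v ≡ v′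
stack-injective {j} {m} {v} {j′} {m′} {v′} total eq
  rewrite total with ++-∷-injective (desc (suc m) j) (desc (suc m′) j′)
                      (subst (λ k → All (_< suc k) (desc (suc m) j)) total (desc-< (suc m) j))
                      (desc-< (suc m′) j′) eq
... | p≡p′ , v≡v′ =
  trans (sym (length-desc (suc m) j)) (trans (cong length p≡p′) (length-desc (suc m′) j′)) , v≡v′

-- antidiagonalSum w j m = Σ_{i ≤ m} w (j + i) (m ∸ i)
antidiagonalSum : (ℕ → ℕ → ℕ) → ℕ → ℕ → ℕ
antidiagonalSum w j zero    = w j 0
antidiagonalSum w j (suc m) = w j (suc m) + antidiagonalSum w (suc j) m

antidiagonal : {X : Set} → (ℕ → ℕ → List X) → ℕ → ℕ → List X
antidiagonal F j zero    = F j 0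
antidiagonal F j (suc m) = F j (suc m) ++ antidiagonal F (suc j) m

antidiagonalSum-cong : ∀ {w w′} → (∀ j m → w j m ≡ w′ j m) → ∀ j m →
  antidiagonalSum w j m ≡ antidiagonalSum w′ j m
antidiagonalSum-cong w≗w′ j zero    = w≗w′ j 0
antidiagonalSum-cong w≗w′ j (suc m) =
  cong₂ _+_ (w≗w′ j (suc m)) (antidiagonalSum-cong w≗w′ (suc j) m)

module _ {X : Set} (F : ℕ → ℕ → List X) where

  length-antidiagonal : ∀ j m →
    length (antidiagonal F j m) ≡ antidiagonalSum (λ j m → length (F j m)) j m
  length-antidiagonal j zero    = refl
  length-antidiagonal j (suc m) =
    trans (length-++ (F j (suc m))) (cong (length (F j (suc m)) +_) (length-antidiagonal (suc j) m))

  ∈-antidiagonal⁻ : ∀ j m {z} → z ∈ antidiagonal F j m →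
    ∃[ j′ ] ∃[ m′ ] j ≤ j′ × m′ + j′ ≡ m + j × z ∈ F j′ m′
  ∈-antidiagonal⁻ j zero    z∈ = j , 0 , ≤-refl , refl , z∈
  ∈-antidiagonal⁻ j (suc m) z∈ with ∈-++⁻ (F j (suc m)) z∈
  ... | inj₁ z∈F = j , suc m , ≤-refl , refl , z∈F
  ... | inj₂ z∈A with ∈-antidiagonal⁻ (suc j) m z∈A
  ...   | j′ , m′ , j<j′ , total , z∈F = j′ , m′ , <⇒≤ j<j′ , trans total (+-suc m j) , z∈F

  ∈-antidiagonal⁺ : ∀ j m {j′ m′ z} → j ≤ j′ → m′ + j′ ≡ m + j → z ∈ F j′ m′ →
    z ∈ antidiagonal F j m
  ∈-antidiagonal⁺ j zero {j′} {m′} {z} j≤j′ total z∈ = subst₂ (λ a b → z ∈ F a b) j′≡j m′≡0 z∈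
    where
    j′≡j : j′ ≡ j
    j′≡j = ≤-antisym (≤-trans (m≤n+m j′ m′) (≤-reflexive total)) j≤j′
    m′≡0 : m′ ≡ 0
    m′≡0 = +-cancelʳ-≡ j′ m′ 0 (trans total (sym j′≡j))
  ∈-antidiagonal⁺ j (suc m) {j′} {m′} {z} j≤j′ total z∈ with j′ ≟ j
  ... | yes refl = ∈-++⁺ˡ (subst (λ k → z ∈ F j k) (+-cancelʳ-≡ j m′ (suc m) total) z∈)
  ... | no j′≢j  = ∈-++⁺ʳ (F j (suc m))
    (∈-antidiagonal⁺ (suc j) m (≤∧≢⇒< j≤j′ (j′≢j ∘ sym)) (trans total (sym (+-suc m j))) z∈)

  Unique-antidiagonal : (∀ j m → Unique (F j m)) →
    (∀ {j m j′ m′ z} → m + j ≡ m′ + j′ → z ∈ F j m → z ∈ F j′ m′ → j ≡ j′) →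
    ∀ j m → Unique (antidiagonal F j m)
  Unique-antidiagonal unique separated j zero    = unique j 0
  Unique-antidiagonal unique separated j (suc m) =
    Unique.++⁺ (unique j (suc m)) (Unique-antidiagonal unique separated (suc j) m) disjoint
    where
    disjoint : Disjoint (F j (suc m)) (antidiagonal F (suc j) m)
    disjoint (z∈F , z∈A) with ∈-antidiagonal⁻ (suc j) m z∈A
    ... | j′ , m′ , j<j′ , total , z∈F′ =
      <-irrefl (sym (separated (trans total (+-suc m j)) z∈F′ z∈F)) j<j′

switchAt : ℕ → (ℕ → ℕ) → (ℕ → ℕ) → ℕ → ℕ → ℕ
switchAt k A D j m = if j <ᵇ k then A m else D m

-- coefficient of x^m in x^k g(x)
shiftBy : ℕ → (ℕ → ℕ) → ℕ → ℕ
shiftBy k g m = if k <ᵇ suc m then g (m ∸ k) else 0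

module _ (A D : ℕ → ℕ) where

  antidiagonalSum-switchAt-suc : ∀ k j m →
    antidiagonalSum (switchAt (suc k) A D) (suc j) m ≡ antidiagonalSum (switchAt k A D) j m
  antidiagonalSum-switchAt-suc k j zero    = refl
  antidiagonalSum-switchAt-suc k j (suc m) =
    cong (switchAt k A D j (suc m) +_) (antidiagonalSum-switchAt-suc k (suc j) m)

  antidiagonalSum-switchAt-zero : ∀ j m →
    antidiagonalSum (switchAt 0 A D) (suc j) m ≡ antidiagonalSum (switchAt 0 A D) j m
  antidiagonalSum-switchAt-zero j zero    = refl
  antidiagonalSum-switchAt-zero j (suc m) = cong (D (suc m) +_) (antidiagonalSum-switchAt-zero (suc j) m)

  antidiagonalSum-switchAt-step : ∀ k m →
    antidiagonalSum (switchAt k A D) 0 m + shiftBy k A m ≡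
    antidiagonalSum (switchAt (suc k) A D) 0 m + shiftBy k D m
  antidiagonalSum-switchAt-step zero    zero    = +-comm (D 0) (A 0)
  antidiagonalSum-switchAt-step zero    (suc m)
    rewrite antidiagonalSum-switchAt-zero 0 m | antidiagonalSum-switchAt-suc 0 0 m =
      swap-outer (D (suc m)) (antidiagonalSum (switchAt 0 A D) 0 m) (A (suc m))
    where
    swap-outer : ∀ d s a → d + s + a ≡ a + s + d
    swap-outer = solve-∀
  antidiagonalSum-switchAt-step (suc k) zero    = refl
  antidiagonalSum-switchAt-step (suc k) (suc m) = begin
    A (suc m) + antidiagonalSum (switchAt (suc k) A D) 1 m + shiftBy k A m
      ≡⟨ cong (λ s → A (suc m) + s + shiftBy k A m) (antidiagonalSum-switchAt-suc k 0 m) ⟩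
    A (suc m) + antidiagonalSum (switchAt k A D) 0 m + shiftBy k A m
      ≡⟨ +-assoc (A (suc m)) _ _ ⟩
    A (suc m) + (antidiagonalSum (switchAt k A D) 0 m + shiftBy k A m)
      ≡⟨ cong (A (suc m) +_) (antidiagonalSum-switchAt-step k m) ⟩
    A (suc m) + (antidiagonalSum (switchAt (suc k) A D) 0 m + shiftBy k D m)
      ≡⟨ +-assoc (A (suc m)) _ _ ⟨
    A (suc m) + antidiagonalSum (switchAt (suc k) A D) 0 m + shiftBy k D m
      ≡⟨ cong (λ s → A (suc m) + s + shiftBy k D m) (antidiagonalSum-switchAt-suc (suc k) 0 m) ⟨
    A (suc m) + antidiagonalSum (switchAt (suc (suc k)) A D) 1 m + shiftBy k D m
      ∎
    where open ≡-Reasoning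

  switchAt-recurrence : ∀ k → (∀ n → A (suc n) ≡ antidiagonalSum (switchAt (suc k) A D) 0 n) →
    ∀ n → A (2 + n) + shiftBy k A n ≡ A (1 + n) + A (1 + n) + shiftBy k D n
  switchAt-recurrence k A-rec n = begin
    A (2 + n) + shiftBy k A n
      ≡⟨ cong (_+ shiftBy k A n) (A-rec (suc n)) ⟩
    A (1 + n) + antidiagonalSum (switchAt (suc k) A D) 1 n + shiftBy k A n
      ≡⟨ cong (λ s → A (1 + n) + s + shiftBy k A n) (antidiagonalSum-switchAt-suc k 0 n) ⟩
    A (1 + n) + antidiagonalSum (switchAt k A D) 0 n + shiftBy k A n
      ≡⟨ +-assoc (A (1 + n)) _ _ ⟩
    A (1 + n) + (antidiagonalSum (switchAt k A D) 0 n + shiftBy k A n)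
      ≡⟨ cong (A (1 + n) +_) (antidiagonalSum-switchAt-step k n) ⟩
    A (1 + n) + (antidiagonalSum (switchAt (suc k) A D) 0 n + shiftBy k D n)
      ≡⟨ cong (λ s → A (1 + n) + (s + shiftBy k D n)) (A-rec n) ⟨
    A (1 + n) + (A (1 + n) + shiftBy k D n)
      ≡⟨ +-assoc (A (1 + n)) _ _ ⟨
    A (1 + n) + A (1 + n) + shiftBy k D n
      ∎
    where open ≡-Reasoning

module Counting (b c : ℕ) where

  Rγ : List (List ℕ)
  Rγ = p123 ∷ p132 ∷ γ 0 (suc b) (suc c) ∷ []

  Rδ : List (List ℕ)
  Rδ = p123 ∷ p132 ∷ γ 0 0 c ∷ []

  A : ℕ → ℕ
  A n = countAvoid n Rγ

  D : ℕ → ℕ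
  D n = countAvoid n Rδ

  -- the permutations v with stack j m v ∈ S_{m+j+1}(Rγ)
  tails : ℕ → ℕ → List (List ℕ)
  tails j m = if j <ᵇ suc b then SAvoid m Rγ else SAvoid m Rδ

  stacks : ℕ → ℕ → List (List ℕ)
  stacks j m = map (stack j m) (tails j m)

  stack-∈-SAvoid⇒∈-tails : ∀ j m {v} → IsPermutation m v →
    stack j m v ∈ SAvoid (suc (m + j)) Rγ → v ∈ tails j m
  stack-∈-SAvoid⇒∈-tails j m {v} perm z∈ with ∈-SAvoid⁻ (suc (m + j)) Rγ z∈
  ... | _ , ¬123 ∷ ¬132 ∷ ¬γ ∷ [] with j <ᵇ suc b in eq
  ...   | true  =
    ∈-SAvoid⁺ m Rγ perm (avoids-tail _ _ v ¬123 ∷ avoids-tail _ _ v ¬132 ∷ avoids-tail _ _ v ¬γ ∷ [])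
  ...   | false = ∈-SAvoid⁺ m Rδ perm (avoids-tail _ _ v ¬123 ∷ avoids-tail _ _ v ¬132 ∷ ¬δ ∷ [])
    where
    ¬δ : ¬ Contains v (γ 0 0 c)
    ¬δ o = ¬γ (Stacked-contains-γ⇐ (stack-stacked j m (proj₁ (proj₂ perm))) (suc b) (suc c)
      (inj₁ (subst (suc b ≤_) (sym (length-desc (suc m) j)) (<ᵇ-false⇒≥ eq) , Contains-δ⇒ c o)))

  stack-∈-SAvoid : ∀ j m {v} → IsPermutation m v → ¬ Contains v p123 → ¬ Contains v p132 →
    ¬ Contains (stack j m v) (γ 0 (suc b) (suc c)) → stack j m v ∈ SAvoid (suc (m + j)) Rγ
  stack-∈-SAvoid j m perm ¬123 ¬132 ¬γ =
    ∈-SAvoid⁺ _ Rγ (stack-permutation j m perm)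
      (Stacked-avoids SameOrder-123⇒ st ¬123 ∷ Stacked-avoids SameOrder-132⇒ st ¬132 ∷ ¬γ ∷ [])
    where st = stack-stacked j m (proj₁ (proj₂ perm))

  ∈-tails⇒stack-∈-SAvoid : ∀ j m {v} → v ∈ tails j m → stack j m v ∈ SAvoid (suc (m + j)) Rγ
  ∈-tails⇒stack-∈-SAvoid j m {v} v∈ with j <ᵇ suc b in eq
  ... | true with ∈-SAvoid⁻ m Rγ v∈
  ...   | perm , ¬123 ∷ ¬132 ∷ ¬γ ∷ [] = stack-∈-SAvoid j m perm ¬123 ¬132 λ o →
    [ (λ (b<p , _) → <⇒≱ (<ᵇ-true⇒< eq) (subst (suc b ≤_) (length-desc (suc m) j) b<p)) , ¬γ ]′
      (Stacked-contains-γ⇒ (stack-stacked j m (proj₁ (proj₂ perm))) b (suc c) o)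
  ∈-tails⇒stack-∈-SAvoid j m {v} v∈ | false with ∈-SAvoid⁻ m Rδ v∈
  ...   | perm , ¬123 ∷ ¬132 ∷ ¬δ ∷ [] = stack-∈-SAvoid j m perm ¬123 ¬132 λ o →
    ¬δ (Contains-δ⇐ c ([ proj₂ , Contains-γ⇒HasDecreasing (suc b) (suc c) ]′
      (Stacked-contains-γ⇒ (stack-stacked j m (proj₁ (proj₂ perm))) b (suc c) o)))

  ∈-SAvoid⇒∈-stacks : ∀ n {z} → z ∈ SAvoid (suc n) Rγ → z ∈ antidiagonal stacks 0 n
  ∈-SAvoid⇒∈-stacks n z∈ with ∈-SAvoid⁻ (suc n) Rγ z∈
  ... | perm , ¬123 ∷ ¬132 ∷ _ with avoider-decomposition n perm ¬123 ¬132
  ...   | m , j , v , m+j≡n , refl , perm-v =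
    ∈-antidiagonal⁺ stacks 0 n z≤n (trans m+j≡n (sym (+-identityʳ n)))
      (∈-map⁺ (stack j m) (stack-∈-SAvoid⇒∈-tails j m perm-v
        (subst (λ k → stack j m v ∈ SAvoid (suc k) Rγ) (sym m+j≡n) z∈)))

  ∈-stacks⇒∈-SAvoid : ∀ n {z} → z ∈ antidiagonal stacks 0 n → z ∈ SAvoid (suc n) Rγ
  ∈-stacks⇒∈-SAvoid n z∈ with ∈-antidiagonal⁻ stacks 0 n z∈
  ... | j , m , _ , total , z∈′ with ∈-map⁻ (stack j m) z∈′
  ...   | v , v∈ , refl =
    subst (λ k → stack j m v ∈ SAvoid (suc k) Rγ) (trans total (+-identityʳ n))
      (∈-tails⇒stack-∈-SAvoid j m v∈)

  Unique-stacks : ∀ n → Unique (antidiagonal stacks 0 n)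
  Unique-stacks = Unique-antidiagonal stacks unique separated 0
    where
    unique : ∀ j m → Unique (stacks j m)
    unique j m = Unique.map⁺ (λ eq → proj₂ (stack-injective refl eq)) (Unique-tails j m)
      where
      Unique-tails : ∀ j m → Unique (tails j m)
      Unique-tails j m with j <ᵇ suc b
      ... | true  = Unique-SAvoid m Rγ
      ... | false = Unique-SAvoid m Rδ
    separated : ∀ {j m j′ m′ z} → m + j ≡ m′ + j′ → z ∈ stacks j m → z ∈ stacks j′ m′ → j ≡ j′
    separated {j} {m} {j′} {m′} total z∈ z∈′ with ∈-map⁻ (stack j m) z∈ | ∈-map⁻ (stack j′ m′) z∈′
    ... | _ , _ , refl | _ , _ , eq = proj₁ (stack-injective total eq)

  A-antidiagonal : ∀ n → A (suc n) ≡ antidiagonalSum (switchAt (suc b) A D) 0 n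
  A-antidiagonal n = begin
    length (SAvoid (suc n) Rγ)
      ≡⟨ ↭-length (∼bag⇒↭ (unique∧set⇒bag (Unique-SAvoid (suc n) Rγ) (Unique-stacks n)
           (mk⇔ (∈-SAvoid⇒∈-stacks n) (∈-stacks⇒∈-SAvoid n)))) ⟩
    length (antidiagonal stacks 0 n)
      ≡⟨ length-antidiagonal stacks 0 n ⟩
    antidiagonalSum (λ j m → length (stacks j m)) 0 n
      ≡⟨ antidiagonalSum-cong (λ j m → trans (length-map (stack j m) (tails j m))
                                             (if-float length (j <ᵇ suc b))) 0 n ⟩
    antidiagonalSum (switchAt (suc b) A D) 0 n
      ∎
    where open ≡-Reasoning

∑< : ℕ → (ℕ → ℤ) → ℤ
∑< zero    g = 0ℤ
∑< (suc n) g = g 0 +ℤ ∑< n (g ∘ suc)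

∑<-cong : ∀ n {g h} → (∀ i → i < n → g i ≡ h i) → ∑< n g ≡ ∑< n h
∑<-cong zero    _   = refl
∑<-cong (suc n) g≗h = cong₂ _+ℤ_ (g≗h 0 z<s) (∑<-cong n (λ i i<n → g≗h (suc i) (s<s i<n)))

∑<-+ : ∀ n g h → ∑< n (λ i → g i +ℤ h i) ≡ ∑< n g +ℤ ∑< n h
∑<-+ zero    g h = refl
∑<-+ (suc n) g h =
  trans (cong (g 0 +ℤ h 0 +ℤ_) (∑<-+ n (g ∘ suc) (h ∘ suc))) (interchange (g 0) (h 0) _ _)
  where
  interchange : ∀ a b c d → (a +ℤ b) +ℤ (c +ℤ d) ≡ (a +ℤ c) +ℤ (b +ℤ d)
  interchange = ℤ-solve-∀

∑<-neg : ∀ n g → ∑< n (λ i → -ℤ g i) ≡ -ℤ ∑< n g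
∑<-neg zero    g = refl
∑<-neg (suc n) g = trans (cong (-ℤ g 0 +ℤ_) (∑<-neg n (g ∘ suc))) (sym (ℤ.neg-distrib-+ (g 0) _))

∑<-snoc : ∀ n g → ∑< (suc n) g ≡ ∑< n g +ℤ g n
∑<-snoc zero    g = ℤ.+-comm (g 0) 0ℤ
∑<-snoc (suc n) g = trans (cong (g 0 +ℤ_) (∑<-snoc n (g ∘ suc))) (sym (ℤ.+-assoc (g 0) _ _))

∑<-reverse : ∀ n g → ∑< n g ≡ ∑< n (λ i → g (n ∸ suc i))
∑<-reverse zero    g = refl
∑<-reverse (suc n) g =
  trans (∑<-snoc n g) (trans (cong (_+ℤ g n) (∑<-reverse n g)) (ℤ.+-comm _ (g n)))

∑<-X^ : ∀ k n (G : ℕ → ℤ) → ∑< n (λ i → X^ k i *ℤ G i) ≡ (if k <ᵇ n then G k else 0ℤ)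
∑<-X^ k       zero    G = refl
∑<-X^ zero    (suc n) G = begin
  1ℤ *ℤ G 0 +ℤ ∑< n (λ i → 0ℤ *ℤ G (suc i))  ≡⟨ cong₂ _+ℤ_ (ℤ.*-identityˡ (G 0))
                                                       (∑<-cong n (λ i _ → ℤ.*-zeroˡ (G (suc i)))) ⟩
  G 0 +ℤ ∑< n (λ _ → 0ℤ)                       ≡⟨ cong (G 0 +ℤ_) (∑<-zero n) ⟩
  G 0 +ℤ 0ℤ                                    ≡⟨ ℤ.+-identityʳ (G 0) ⟩
  G 0                                          ∎
  where
  open ≡-Reasoning
  ∑<-zero : ∀ n → ∑< n (λ _ → 0ℤ) ≡ 0ℤ
  ∑<-zero zero    = refl
  ∑<-zero (suc n) = trans (ℤ.+-identityˡ _) (∑<-zero n)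
∑<-X^ (suc k) (suc n) G = trans (ℤ.+-identityˡ _) (∑<-X^ k n (G ∘ suc))

*ₛ-as-∑< : ∀ (F G : FPS) n → (F *ₛ G) n ≡ ∑< (suc n) (λ i → F i *ℤ G (n ∸ i))
*ₛ-as-∑< F G n = sum-applyUpTo id (suc n)
  where
  sum-applyUpTo : ∀ (h : ℕ → ℕ) k →
    sumℤ (map (λ i → F i *ℤ G (n ∸ i)) (applyUpTo h k)) ≡ ∑< k (λ i → F (h i) *ℤ G (n ∸ h i))
  sum-applyUpTo h zero    = refl
  sum-applyUpTo h (suc k) = cong (F (h 0) *ℤ G (n ∸ h 0) +ℤ_) (sum-applyUpTo (h ∘ suc) k)

X^-*ₛ : ∀ k (G : FPS) n → (X^ k *ₛ G) n ≡ (if k <ᵇ suc n then G (n ∸ k) else 0ℤ)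
X^-*ₛ k G n = trans (*ₛ-as-∑< (X^ k) G n) (∑<-X^ k (suc n) (λ i → G (n ∸ i)))

*ₛ-distribʳ-+ₛ : ∀ (F F′ G : FPS) n → ((F +ₛ F′) *ₛ G) n ≡ (F *ₛ G) n +ℤ (F′ *ₛ G) n
*ₛ-distribʳ-+ₛ F F′ G n = begin
  ((F +ₛ F′) *ₛ G) n
    ≡⟨ *ₛ-as-∑< (F +ₛ F′) G n ⟩
  ∑< (suc n) (λ i → (F i +ℤ F′ i) *ℤ G (n ∸ i))
    ≡⟨ ∑<-cong (suc n) (λ i _ → ℤ.*-distribʳ-+ (G (n ∸ i)) (F i) (F′ i)) ⟩
  ∑< (suc n) (λ i → F i *ℤ G (n ∸ i) +ℤ F′ i *ℤ G (n ∸ i))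
    ≡⟨ ∑<-+ (suc n) (λ i → F i *ℤ G (n ∸ i)) (λ i → F′ i *ℤ G (n ∸ i)) ⟩
  ∑< (suc n) (λ i → F i *ℤ G (n ∸ i)) +ℤ ∑< (suc n) (λ i → F′ i *ℤ G (n ∸ i))
    ≡⟨ cong₂ _+ℤ_ (*ₛ-as-∑< F G n) (*ₛ-as-∑< F′ G n) ⟨
  (F *ₛ G) n +ℤ (F′ *ₛ G) n
    ∎
  where open ≡-Reasoning

-ₛ-*ₛ : ∀ (F G : FPS) n → ((-ₛ F) *ₛ G) n ≡ -ℤ (F *ₛ G) n
-ₛ-*ₛ F G n = begin
  ((-ₛ F) *ₛ G) n
    ≡⟨ *ₛ-as-∑< (-ₛ F) G n ⟩
  ∑< (suc n) (λ i → -ℤ F i *ℤ G (n ∸ i))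
    ≡⟨ ∑<-cong (suc n) (λ i _ → sym (ℤ.neg-distribˡ-* (F i) (G (n ∸ i)))) ⟩
  ∑< (suc n) (λ i → -ℤ (F i *ℤ G (n ∸ i)))
    ≡⟨ ∑<-neg (suc n) (λ i → F i *ℤ G (n ∸ i)) ⟩
  -ℤ ∑< (suc n) (λ i → F i *ℤ G (n ∸ i))
    ≡⟨ cong -ℤ_ (*ₛ-as-∑< F G n) ⟨
  -ℤ (F *ₛ G) n
    ∎
  where open ≡-Reasoning

*ₛ-congʳ : ∀ F {G G′} → G ≈ₛ G′ → (F *ₛ G) ≈ₛ (F *ₛ G′)
*ₛ-congʳ F {G} {G′} G≈G′ n = begin
  (F *ₛ G) n
    ≡⟨ *ₛ-as-∑< F G n ⟩
  ∑< (suc n) (λ i → F i *ℤ G (n ∸ i))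
    ≡⟨ ∑<-cong (suc n) (λ i _ → cong (F i *ℤ_) (G≈G′ (n ∸ i))) ⟩
  ∑< (suc n) (λ i → F i *ℤ G′ (n ∸ i))
    ≡⟨ *ₛ-as-∑< F G′ n ⟨
  (F *ₛ G′) n
    ∎
  where open ≡-Reasoning

*ₛ-comm : ∀ F G → (F *ₛ G) ≈ₛ (G *ₛ F)
*ₛ-comm F G n = begin
  (F *ₛ G) n
    ≡⟨ *ₛ-as-∑< F G n ⟩
  ∑< (suc n) (λ i → F i *ℤ G (n ∸ i))
    ≡⟨ ∑<-reverse (suc n) (λ i → F i *ℤ G (n ∸ i)) ⟩
  ∑< (suc n) (λ i → F (n ∸ i) *ℤ G (n ∸ (n ∸ i)))
    ≡⟨ ∑<-cong (suc n) (λ i i≤n → cong (F (n ∸ i) *ℤ_) (cong G (m∸[m∸n]≡n (≤-pred i≤n)))) ⟩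
  ∑< (suc n) (λ i → F (n ∸ i) *ℤ G i)
    ≡⟨ ∑<-cong (suc n) (λ i _ → ℤ.*-comm (F (n ∸ i)) (G i)) ⟩
  ∑< (suc n) (λ i → G i *ℤ F (n ∸ i))
    ≡⟨ *ₛ-as-∑< G F n ⟨
  (G *ₛ F) n
    ∎
  where open ≡-Reasoning

sumPowers-0 : ∀ b → sumPowers b 0 ≡ 0ℤ
sumPowers-0 zero    = refl
sumPowers-0 (suc b) = trans (ℤ.+-identityʳ _) (sumPowers-0 b)

sumPowers-1 : ∀ b → sumPowers (suc b) 1 ≡ 1ℤ
sumPowers-1 zero    = refl
sumPowers-1 (suc b) = trans (ℤ.+-identityʳ _) (sumPowers-1 b)

-- (1 - x) (x + ⋯ + x^b) = x - x^(b+1), read off in degree k + 2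
sumPowers-difference : ∀ b k → sumPowers b (1 + k) +ℤ -ℤ sumPowers b (2 + k) ≡ X^ (suc b) (2 + k)
sumPowers-difference zero    k = refl
sumPowers-difference (suc b) k = begin
  (s₁ +ℤ x₁) +ℤ -ℤ (s₂ +ℤ x₂)   ≡⟨ regroup s₁ s₂ x₁ x₂ ⟩
  (s₁ +ℤ -ℤ s₂) +ℤ x₁ +ℤ -ℤ x₂  ≡⟨ cong (λ d → d +ℤ x₁ +ℤ -ℤ x₂) (sumPowers-difference b k) ⟩
  x₂ +ℤ x₁ +ℤ -ℤ x₂             ≡⟨ cancel x₁ x₂ ⟩
  x₁                            ∎
  where
  open ≡-Reasoning
  s₁ = sumPowers b (1 + k)
  s₂ = sumPowers b (2 + k)
  x₁ = X^ (suc b) (1 + k)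
  x₂ = X^ (suc b) (2 + k)
  regroup : ∀ s₁ s₂ x₁ x₂ → (s₁ +ℤ x₁) +ℤ -ℤ (s₂ +ℤ x₂) ≡ (s₁ +ℤ -ℤ s₂) +ℤ x₁ +ℤ -ℤ x₂
  regroup = ℤ-solve-∀
  cancel : ∀ x₁ x₂ → x₂ +ℤ x₁ +ℤ -ℤ x₂ ≡ x₁
  cancel = ℤ-solve-∀

denominator-expansion : ∀ b →
  ((oneₛ -ₛ X^ 1) *ₛ (oneₛ -ₛ sumPowers (suc b))) ≈ₛ ((oneₛ -ₛ (X^ 1 +ₛ X^ 1)) +ₛ X^ (2 + b))
denominator-expansion b k =
  trans (*ₛ-distribʳ-+ₛ oneₛ (-ₛ X^ 1) P k)
    (trans (cong₂ _+ℤ_ (X^-*ₛ 0 P k) (trans (-ₛ-*ₛ (X^ 1) P k) (cong -ℤ_ (X^-*ₛ 1 P k))))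
      (coefficient k))
  where
  P = oneₛ -ₛ sumPowers (suc b)
  coefficient : ∀ k →
    P k +ℤ -ℤ (if 1 <ᵇ suc k then P (k ∸ 1) else 0ℤ) ≡ ((oneₛ -ₛ (X^ 1 +ₛ X^ 1)) +ₛ X^ (2 + b)) k
  coefficient zero          rewrite sumPowers-0 (suc b) = refl
  coefficient (suc zero)    rewrite sumPowers-0 (suc b) | sumPowers-1 b = refl
  coefficient (suc (suc k)) = trans (flip-difference (sumPowers (suc b) (2 + k)) (sumPowers (suc b) (1 + k)))
                                    (trans (sumPowers-difference (suc b) k) (sym (ℤ.+-identityˡ _)))
    where
    flip-difference : ∀ s₂ s₁ → (0ℤ +ℤ -ℤ s₂) +ℤ -ℤ (0ℤ +ℤ -ℤ s₁) ≡ s₁ +ℤ -ℤ s₂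
    flip-difference = ℤ-solve-∀

shiftₛ : ℕ → FPS → FPS
shiftₛ k G n = if k <ᵇ suc n then G (n ∸ k) else 0ℤ

expansion-*ₛ : ∀ k G n → (((oneₛ -ₛ (X^ 1 +ₛ X^ 1)) +ₛ X^ k) *ₛ G) n ≡
  G n +ℤ -ℤ (shiftₛ 1 G n +ℤ shiftₛ 1 G n) +ℤ shiftₛ k G n
expansion-*ₛ k G n =
  trans (*ₛ-distribʳ-+ₛ (oneₛ -ₛ (X^ 1 +ₛ X^ 1)) (X^ k) G n)
    (cong₂ _+ℤ_
      (trans (*ₛ-distribʳ-+ₛ oneₛ (-ₛ (X^ 1 +ₛ X^ 1)) G n)
        (cong₂ _+ℤ_ (X^-*ₛ 0 G n)
          (trans (-ₛ-*ₛ (X^ 1 +ₛ X^ 1) G n)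
            (cong -ℤ_ (trans (*ₛ-distribʳ-+ₛ (X^ 1) (X^ 1) G n)
                             (cong₂ _+ℤ_ (X^-*ₛ 1 G n) (X^-*ₛ 1 G n)))))))
      (X^-*ₛ k G n))

recurrence⇒coefficients : ∀ (A D : ℕ → ℕ) k → A 0 ≡ 1 → A 1 ≡ 1 →
  (∀ n → A (2 + n) + shiftBy k A n ≡ A (1 + n) + A (1 + n) + shiftBy k D n) →
  let F = ℤ.pos ∘ A in
  ∀ n → F n +ℤ -ℤ (shiftₛ 1 F n +ℤ shiftₛ 1 F n) +ℤ shiftₛ (2 + k) F n
        ≡ (oneₛ -ₛ X^ 1) n +ℤ shiftₛ (2 + k) (ℤ.pos ∘ D) n
recurrence⇒coefficients A D k A0 A1 rec zero          rewrite A0 = refl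
recurrence⇒coefficients A D k A0 A1 rec (suc zero)    rewrite A0 | A1 = refl
recurrence⇒coefficients A D k A0 A1 rec (suc (suc n))
  rewrite sym (if-float ℤ.pos (k <ᵇ suc n) {A (n ∸ k)} {0})
        | sym (if-float ℤ.pos (k <ᵇ suc n) {D (n ∸ k)} {0}) = begin
  x +ℤ -ℤ (u +ℤ u) +ℤ y   ≡⟨ regroup x y u ⟩
  (x +ℤ y) +ℤ -ℤ (u +ℤ u) ≡⟨ cong (_+ℤ -ℤ (u +ℤ u)) lifted ⟩
  (u +ℤ u +ℤ w) +ℤ -ℤ (u +ℤ u) ≡⟨ cancel u w ⟩
  0ℤ +ℤ -ℤ 0ℤ +ℤ w        ∎
  where
  open ≡-Reasoning
  x = ℤ.pos (A (2 + n))
  y = ℤ.pos (shiftBy k A n)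
  u = ℤ.pos (A (1 + n))
  w = ℤ.pos (shiftBy k D n)
  lifted : x +ℤ y ≡ u +ℤ u +ℤ w
  lifted = begin
    x +ℤ y                                       ≡⟨ ℤ.pos-+ (A (2 + n)) (shiftBy k A n) ⟨
    ℤ.pos (A (2 + n) + shiftBy k A n)            ≡⟨ cong ℤ.pos (rec n) ⟩
    ℤ.pos (A (1 + n) + A (1 + n) + shiftBy k D n) ≡⟨ ℤ.pos-+ (A (1 + n) + A (1 + n)) (shiftBy k D n) ⟩
    ℤ.pos (A (1 + n) + A (1 + n)) +ℤ w           ≡⟨ cong (_+ℤ w) (ℤ.pos-+ (A (1 + n)) (A (1 + n))) ⟩
    u +ℤ u +ℤ w                                  ∎
  regroup : ∀ x y u → x +ℤ -ℤ (u +ℤ u) +ℤ y ≡ (x +ℤ y) +ℤ -ℤ (u +ℤ u)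
  regroup = ℤ-solve-∀
  cancel : ∀ u w → (u +ℤ u +ℤ w) +ℤ -ℤ (u +ℤ u) ≡ 0ℤ +ℤ -ℤ 0ℤ +ℤ w
  cancel = ℤ-solve-∀

mainTheorem5 : (b c : ℕ) → 1 ≤ b → 1 ≤ c →
    (f 0 b c *ₛ ((oneₛ -ₛ X^ 1) *ₛ (oneₛ -ₛ sumPowers b)))
      ≈ₛ ((oneₛ -ₛ X^ 1) +ₛ (X^ (suc b) *ₛ f 0 0 (c ∸ 1)))
mainTheorem5 (suc b) (suc c) _ _ n = begin
  (F *ₛ ((oneₛ -ₛ X^ 1) *ₛ (oneₛ -ₛ sumPowers (suc b)))) n
    ≡⟨ *ₛ-congʳ F (denominator-expansion b) n ⟩
  (F *ₛ H) n
    ≡⟨ *ₛ-comm F H n ⟩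
  (H *ₛ F) n
    ≡⟨ expansion-*ₛ (2 + b) F n ⟩
  F n +ℤ -ℤ (shiftₛ 1 F n +ℤ shiftₛ 1 F n) +ℤ shiftₛ (2 + b) F n
    ≡⟨ recurrence⇒coefficients A D b refl (A-antidiagonal 0)
         (switchAt-recurrence A D b A-antidiagonal) n ⟩
  (oneₛ -ₛ X^ 1) n +ℤ shiftₛ (2 + b) (f 0 0 c) n
    ≡⟨ cong ((oneₛ -ₛ X^ 1) n +ℤ_) (X^-*ₛ (2 + b) (f 0 0 c) n) ⟨
  ((oneₛ -ₛ X^ 1) +ₛ (X^ (2 + b) *ₛ f 0 0 c)) n
    ∎
  where
  open ≡-Reasoning
  open Counting b c
  F = f 0 (suc b) (suc c)
  H = (oneₛ -ₛ (X^ 1 +ₛ X^ 1)) +ₛ X^ (2 + b)
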